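{- Let $n\ge 4$, let $A=\{a_1,\dots,a_m\}$ with $1 \le a_1<a_2<\dots<a_m \le n-1$, and let $s$ be an arbitrary vertex of $QJ(n,A)$. Then (i) every vertex of $J(n,a_i)$, $1\le i<m$, has a neighbor in $J(n,a_{i+1})$ different from $s$; (ii) every vertex of $J(n,a_i)$, $1< i\le m$, has a neighbor in $J(n,a_{i-1})$ different from $s$.
   Context: Let $[n]=\{1,\dots,n\}$. The Johnson graph $J(n,k)$ has as vertices the $k$-element subsets of $[n]$, two being adjacent if they share exactly $k-1$ elements. For a nonempty $A=\{a_1<a_2<\dots<a_m\}\subseteq[n]$, the graph $QJ(n,A)$ is obtained by taking, for each $i$, a copy of $J(n,a_i)$ (level $i$), and, for each $i<m$, adding an edge between a vertex $u$ of $J(n,a_i)$ and a vertex $v$ of $J(n,a_{i+1})$ whenever $u\subseteq v$. There are no other edges. -}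

module Defs where

open import Data.Nat using (ℕ; suc; _<_; _≤_)
open import Data.Fin using (Fin; toℕ)
open import Data.Fin.Subset using (Subset; ∣_∣; _∩_; _⊆_)
open import Data.Sum using (_⊎_)
open import Data.Product using (_×_)
open import Relation.Binary.PropositionalEquality using (_≡_)

-- The level sizes A = {a_1 < ... < a_m} are given as a : Fin m → ℕ
-- (level i, 0-based, is a copy of J(n, a i)).
StrictlyIncreasing : {m : ℕ} → (Fin m → ℕ) → Set
StrictlyIncreasing {m} a = ∀ (i j : Fin m) → toℕ i < toℕ j → a i < a j

record Vertex (n m : ℕ) (a : Fin m → ℕ) : Set where
  constructor vtx
  field
    level : Fin m
    set   : Subset n
    size  : ∣ set ∣ ≡ a level
open Vertex public

data Adj {n m : ℕ} {a : Fin m → ℕ} (u v : Vertex n m a) : Set where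
  same : level u ≡ level v → suc ∣ set u ∩ set v ∣ ≡ a (level u) → Adj u v
  up   : toℕ (level v) ≡ suc (toℕ (level u)) → set u ⊆ set v → Adj u v
  down : toℕ (level u) ≡ suc (toℕ (level v)) → set v ⊆ set u → Adj u v

-- For S ⊆ U, every size strictly between ∣ S ∣ and ∣ U ∣ is attained by two distinct sets:
-- at the first element of U outside S one may either take it or leave it out.  With U = ⊤ this
-- gives two a_{i+1}-supersets of a vertex of level i (as a_{i+1} < n), and with S = ⊥ two
-- a_{i-1}-subsets (as 0 < a_{i-1}); at least one of the two differs from s.
module Submission where

open import Defs
open import Data.Nat using (ℕ; suc; _<_; _≤_; _∸_; z≤n; s≤s)
open import Data.Nat.Properties using (≤-reflexive; m≤n⇒m≤1+n; m≤n⇒m<n∨m≡n; <⇒≤)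
open import Data.Fin using (Fin; toℕ; fromℕ<; inject₁) renaming (suc to fsuc)
open import Data.Fin.Properties using (toℕ-fromℕ<; toℕ-inject₁)
open import Data.Fin.Subset using (Subset; ∣_∣; _⊆_; inside; outside; ⊥; ⊤)
open import Data.Fin.Subset.Properties
  using (drop-∷-⊆; out⊆; in⊆in; s⊆s; ⊆-refl; ⊆-min; ⊆-max; ∣⊤∣≡n; ∣⊥∣≡0)
open import Data.Vec using (_∷_; []; here)
open import Data.Vec.Properties using (∷-injectiveʳ; ≡-dec)
open import Data.Bool.Properties using (_≟_)
open import Data.Product using (_×_; ∃-syntax; Σ-syntax; _,_)
open import Data.Sum using (inj₁; inj₂)
open import Function using (_∘_)
open import Relation.Nullary using (yes; no)
open import Relation.Binary.Definitions using (DecidableEquality)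
open import Relation.Binary.PropositionalEquality using (_≡_; _≢_; refl; sym; trans; cong; subst)

Between : ∀ {n} → Subset n → Subset n → ℕ → Subset n → Set
Between S U k T = S ⊆ T × T ⊆ U × ∣ T ∣ ≡ k

record Distinct₂ {A : Set} (P : A → Set) : Set where
  constructor distinct₂
  field
    {fst snd} : A
    P-fst     : P fst
    P-snd     : P snd
    fst≢snd   : fst ≢ snd

avoiding : ∀ {A : Set} {P : A → Set} → DecidableEquality A → Distinct₂ P → (s : A) → ∃[ x ] (P x × x ≢ s)
avoiding _≟A_ (distinct₂ {x} px py x≢y) s with x ≟A s
... | yes x≡s = _ , py , λ y≡s → x≢y (trans x≡s (sym y≡s))
... | no  x≢s = x , px , x≢s

∃-between : ∀ {n} {S U : Subset n} {k} → S ⊆ U → ∣ S ∣ ≤ k → k ≤ ∣ U ∣ → ∃[ T ] Between S U k T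
∃-between {S = []}          {[]}          _    _       z≤n     = [] , ⊆-refl , ⊆-refl , refl
∃-between {S = inside ∷ S}  {outside ∷ U} S⊆U  _       _       with S⊆U here
... | ()
∃-between {S = inside ∷ S}  {inside ∷ U}  S⊆U  (s≤s p) (s≤s q) with ∃-between (drop-∷-⊆ S⊆U) p q
... | T , S⊆T , T⊆U , ∣T∣ = inside ∷ T , in⊆in S⊆T , in⊆in T⊆U , cong suc ∣T∣
∃-between {S = outside ∷ S} {outside ∷ U} S⊆U  p       q       with ∃-between (drop-∷-⊆ S⊆U) p q
... | T , S⊆T , T⊆U , ∣T∣ = outside ∷ T , s⊆s S⊆T , s⊆s T⊆U , ∣T∣
∃-between {S = outside ∷ S} {inside ∷ U}  S⊆U  p       q       with m≤n⇒m<n∨m≡n q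
... | inj₂ refl        = inside ∷ U , out⊆ (drop-∷-⊆ S⊆U) , ⊆-refl , refl
... | inj₁ (s≤s k≤∣U∣) with ∃-between (drop-∷-⊆ S⊆U) p k≤∣U∣
...   | T , S⊆T , T⊆U , ∣T∣ = outside ∷ T , s⊆s S⊆T , out⊆ T⊆U , ∣T∣

distinct₂-between : ∀ {n} {S U : Subset n} {k} → S ⊆ U → ∣ S ∣ < k → k < ∣ U ∣
                  → Distinct₂ (Between S U k)
distinct₂-between {S = []}          {[]}          _   _       ()
distinct₂-between {S = inside ∷ S}  {outside ∷ U} S⊆U _       _       with S⊆U here
... | ()
distinct₂-between {S = inside ∷ S}  {inside ∷ U}  S⊆U (s≤s p) (s≤s q)
  with distinct₂-between (drop-∷-⊆ S⊆U) p q
... | distinct₂ (S⊆T , T⊆U , ∣T∣) (S⊆T′ , T′⊆U , ∣T′∣) T≢T′ =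
  distinct₂ (in⊆in S⊆T , in⊆in T⊆U , cong suc ∣T∣) (in⊆in S⊆T′ , in⊆in T′⊆U , cong suc ∣T′∣)
            (T≢T′ ∘ ∷-injectiveʳ)
distinct₂-between {S = outside ∷ S} {outside ∷ U} S⊆U p       q
  with distinct₂-between (drop-∷-⊆ S⊆U) p q
... | distinct₂ (S⊆T , T⊆U , ∣T∣) (S⊆T′ , T′⊆U , ∣T′∣) T≢T′ =
  distinct₂ (s⊆s S⊆T , s⊆s T⊆U , ∣T∣) (s⊆s S⊆T′ , s⊆s T′⊆U , ∣T′∣) (T≢T′ ∘ ∷-injectiveʳ)
distinct₂-between {S = outside ∷ S} {inside ∷ U}  S⊆U (s≤s p) (s≤s q)
  with ∃-between (drop-∷-⊆ S⊆U) p (<⇒≤ q) | ∃-between (drop-∷-⊆ S⊆U) (m≤n⇒m≤1+n p) q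
... | T , S⊆T , T⊆U , ∣T∣ | T′ , S⊆T′ , T′⊆U , ∣T′∣ =
  distinct₂ (out⊆ S⊆T , in⊆in T⊆U , cong suc ∣T∣) (s⊆s S⊆T′ , out⊆ T′⊆U , ∣T′∣) λ ()

distinct₂-supersets : ∀ {n} {S : Subset n} {k} → ∣ S ∣ < k → k < n → Distinct₂ (Between S ⊤ k)
distinct₂-supersets {n} {S} p q = distinct₂-between (⊆-max S) p (subst (_ <_) (sym (∣⊤∣≡n n)) q)

distinct₂-subsets : ∀ {n} {S : Subset n} {k} → 0 < k → k < ∣ S ∣ → Distinct₂ (Between ⊥ S k)
distinct₂-subsets {n} {S} p q = distinct₂-between (⊆-min S) (subst (_< _) (sym (∣⊥∣≡0 n)) p) q

predecessor : ∀ {m} (l : Fin m) → 1 ≤ toℕ l → Σ[ l′ ∈ Fin m ] (suc (toℕ l′) ≡ toℕ l)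
predecessor (fsuc l) _ = inject₁ l , cong suc (toℕ-inject₁ l)

lemma6 : (n m : ℕ) → 4 ≤ n → 1 ≤ m → (a : Fin m → ℕ) → StrictlyIncreasing a
    → (∀ i → 1 ≤ a i) → (∀ i → a i ≤ n ∸ 1)
    → (s : Vertex n m a)
    → ((v : Vertex n m a) → suc (toℕ (level v)) < m
    → ∃[ w ] (toℕ (level w) ≡ suc (toℕ (level v)) × Adj v w × w ≢ s))
    × ((v : Vertex n m a) → 1 ≤ toℕ (level v)
    → ∃[ w ] (suc (toℕ (level w)) ≡ toℕ (level v) × Adj v w × w ≢ s))
lemma6 (suc n) m (s≤s _) _ a increasing positive bounded s = upward , downward
  where
  increasing-step : ∀ {i j} → suc (toℕ i) ≡ toℕ j → a i < a j
  increasing-step {i} {j} i+1≡j = increasing i j (≤-reflexive i+1≡j)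

  upward : (v : Vertex (suc n) m a) → suc (toℕ (level v)) < m
         → ∃[ w ] (toℕ (level w) ≡ suc (toℕ (level v)) × Adj v w × w ≢ s)
  upward (vtx l S ∣S∣) l+1<m
    with avoiding (≡-dec _≟_)
           (distinct₂-supersets (subst (_< _) (sym ∣S∣) (increasing-step (sym (toℕ-fromℕ< l+1<m))))
                                (s≤s (bounded _)))
           (set s)
  ... | T , (S⊆T , _ , ∣T∣) , T≢s =
    vtx (fromℕ< l+1<m) T ∣T∣ , toℕ-fromℕ< l+1<m , up (toℕ-fromℕ< l+1<m) S⊆T , T≢s ∘ cong set

  downward : (v : Vertex (suc n) m a) → 1 ≤ toℕ (level v)
           → ∃[ w ] (suc (toℕ (level w)) ≡ toℕ (level v) × Adj v w × w ≢ s)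
  downward (vtx l S ∣S∣) 1≤l with predecessor l 1≤l
  ... | l′ , l′+1≡l
    with avoiding (≡-dec _≟_)
           (distinct₂-subsets (positive l′) (subst (_ <_) (sym ∣S∣) (increasing-step l′+1≡l)))
           (set s)
  ... | T , (_ , T⊆S , ∣T∣) , T≢s =
    vtx l′ T ∣T∣ , l′+1≡l , down (sym l′+1≡l) T⊆S , T≢s ∘ cong set
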